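{- Let $\bar{a}(N)$ denote the number of partitions $\lambda$ of $N$ with at least two parts, no parts of size $1$, and $\lambda_1=\lambda_2$. For every integer $j\ge 4$, $$PM(3j+2,j+1)-PM(3j,j)=\bar{a}(2j+2)-j.$$
   Context: A partition $\lambda=(\lambda_1\ge\cdots\ge\lambda_\ell)$ of $n$ is a finite nonincreasing sequence of positive integers with sum $n$; $\ell(\lambda)$ is its number of parts. The hook length $h_{(i,j)}(\lambda)$ of a cell $(i,j)$ of the Ferrers diagram is the number of cells consisting of the cell itself, the cells to its right in its row and the cells below it in its column. A numerical set is a subset $S\subseteq\mathbb{N}_0$ containing $0$ with finite complement; a numerical semigroup is a numerical set closed under addition. For a partition $\lambda$ let $S_\lambda=\mathbb{N}_0\setminus\{h_{(i,1)}(\lambda):1\le i\le\ell(\lambda)\}$. $PM(n,m)$ is the number of partitions $\lambda$ of $n$ having exactly $m-1$ parts equal to $1$ such that $S_\lambda$ is a numerical semigroup. -}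

module Defs where

open import Data.Nat using (ℕ; zero; suc; _+_; _∸_; _≤_; _<_; _≥_; _≟_)
open import Data.List using (List; []; _∷_; length; filter)
open import Data.Nat.ListAction using (sum)
open import Data.List.Relation.Unary.All using (All)
open import Data.List.Relation.Unary.Unique.Propositional using (Unique)
open import Data.List.Relation.Unary.Linked using (Linked)
open import Data.List.Membership.Propositional using (_∈_)
open import Data.Product using (Σ; ∃; _×_)
open import Data.Empty using (⊥)
open import Relation.Nullary using (¬_)
open import Relation.Binary.PropositionalEquality using (_≡_)
open import Function.Bundles using (_⇔_)

IsPartition : ℕ → List ℕ → Set
IsPartition n λs = Linked _≥_ λs × All (λ p → 0 < p) λs × sum λs ≡ n

-- First-column hook lengths: h_(i,1) = λ_i + (ℓ - i), i = 1..ℓ.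
firstColHooks : List ℕ → List ℕ
firstColHooks [] = []
firstColHooks (p ∷ ps) = (p + length ps) ∷ firstColHooks ps

InS : List ℕ → ℕ → Set
InS λs x = ¬ (x ∈ firstColHooks λs)

IsNumericalSemigroup : (ℕ → Set) → Set
IsNumericalSemigroup S =
  S 0 × (∃ λ b → ∀ x → b ≤ x → S x) × (∀ x y → S x → S y → S (x + y))

onesCount : List ℕ → ℕ
onesCount λs = length (filter (_≟ 1) λs)

PMPred : ℕ → ℕ → List ℕ → Set
PMPred n m λs = IsPartition n λs × onesCount λs ≡ m ∸ 1 × IsNumericalSemigroup (InS λs)

FirstTwoEqual : List ℕ → Set
FirstTwoEqual [] = ⊥
FirstTwoEqual (_ ∷ []) = ⊥
FirstTwoEqual (x ∷ y ∷ _) = x ≡ y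

ABarPred : ℕ → List ℕ → Set
ABarPred N λs = IsPartition N λs × 2 ≤ length λs × All (λ p → ¬ p ≡ 1) λs × FirstTwoEqual λs

HasCount : (List ℕ → Set) → ℕ → Set
HasCount P k = Σ (List (List ℕ)) λ L → Unique L × (∀ x → (x ∈ L) ⇔ P x) × length L ≡ k

{-# OPTIONS --safe #-}
module Submission where

-- A partition λ with exactly k parts equal to 1 is μ ++ 1^k with μ free of ones, and its first-column
-- hooks are 1, …, k together with h + k for the first-column hooks h of μ. If every hook of the tail
-- (μ₂, μ₃, …) is at most k + 1, the only way S_λ can fail to be additively closed is that the top hook
-- h₁ + k is a sum (a + k) + (b + k) of elements of S_λ, i.e. h₁ − k = a + b with a, b ≥ 1 not hooks of
-- the tail. This condition is unchanged when μ₁ and k both grow by 1. Hence the PM(3j+2, j+1)-partitions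
-- with λ₁ > λ₂ correspond to all PM(3j, j)-partitions (one more cell in the first row, one more part 1),
-- and those with λ₁ = λ₂ are μ ++ 1^j for the μ counted by ā(2j+2) with S_{μ ∪ 1^j} a semigroup. The
-- other ā(2j+2)-partitions are exactly the j partitions (c, c, 2^ℓ) with c + ℓ = j + 1, for which
-- h₁ − j = 2 = 1 + 1 splits.

open import Defs
open import Data.Nat using (ℕ; zero; suc; _+_; _*_; _∸_; _≤_; _<_; _≥_; _≟_; _≤?_; _<?_; z≤n; s≤s; z<s; s≤s⁻¹)
open import Data.Nat.Properties
open import Data.Nat.ListAction using (sum)
open import Data.Nat.ListAction.Properties using (sum-++)
open import Data.Nat.Solver using (module +-*-Solver)
open import Data.Integer using (+_; _-_)
open import Data.Integer.Properties using ([+m]-[+n]≡m⊖n; ⊖-≥)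
open import Data.List
  using (List; []; _∷_; length; filter; map; concatMap; upTo; deduplicate; _++_; replicate)
open import Data.List.Properties
  using (≡-dec; length-map; length-++; length-applyUpTo; length-replicate; filter-reject;
         ∷-injectiveʳ; ++-cancelʳ)
open import Data.List.Relation.Unary.All as All using (All; []; _∷_)
open import Data.List.Relation.Unary.All.Properties using (++⁺; replicate⁺)
open import Data.List.Relation.Unary.Any using (here; there)
open import Data.List.Relation.Unary.Linked as Linked using (Linked; []; [-]; _∷_; linked?)
open import Data.List.Relation.Unary.Unique.Propositional using (Unique)
import Data.List.Relation.Unary.Unique.Propositional.Properties as Unique
open import Data.List.Relation.Unary.Unique.DecPropositional.Properties using (deduplicate-!)
open import Data.List.Relation.Binary.Disjoint.Propositional using (Disjoint)
open import Data.List.Membership.Propositional using (_∈_; _∉_; lose)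
open import Data.List.Membership.Propositional.Properties
  using (∈-map⁺; ∈-map⁻; ∈-++⁺ˡ; ∈-++⁺ʳ; ∈-++⁻; ∈-upTo⁺; ∈-upTo⁻; ∈-concatMap⁺; ∈-filter⁺; ∈-filter⁻;
         ∈-deduplicate⁺; ∈-deduplicate⁻)
open import Data.List.Membership.DecPropositional _≟_ using (_∈?_)
open import Data.Product using (Σ; ∃-syntax; _×_; _,_; proj₁; proj₂; map₂)
open import Data.Sum using (_⊎_; inj₁; inj₂; [_,_]′)
import Data.Sum as Sum
open import Data.Empty using (⊥; ⊥-elim)
open import Relation.Nullary using (Dec; yes; no; ¬_; contradiction)
open import Relation.Nullary.Decidable using (map′; ¬?; _×-dec_; _→-dec_)
open import Relation.Binary.PropositionalEquality
  using (_≡_; _≢_; refl; sym; trans; cong; cong₂; subst; subst₂; module ≡-Reasoning)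
open import Function.Base using (_∘_)
open import Function.Bundles using (_⇔_; mk⇔; Equivalence)
open import Function.Definitions using (Injective)
open import Function.Properties.Equivalence using () renaming (trans to ⇔-trans; sym to ⇔-sym)

open Equivalence using (to; from)

Counts : {A : Set} → (A → Set) → ℕ → Set
Counts {A} P k = Σ (List A) λ L → Unique L × (∀ x → (x ∈ L) ⇔ P x) × length L ≡ k

counts-⇔ : {A : Set} {P Q : A → Set} {k : ℕ} → (∀ x → P x ⇔ Q x) → Counts P k → Counts Q k
counts-⇔ P⇔Q (L , unique , mem , len) = L , unique , (λ x → ⇔-trans (mem x) (P⇔Q x)) , len

counts-upTo : ∀ n → Counts (_< n) n
counts-upTo n = upTo n , Unique.upTo⁺ n , (λ i → mk⇔ ∈-upTo⁻ ∈-upTo⁺) , length-applyUpTo (λ i → i) n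

counts-image : {A B : Set} {P : A → Set} {k : ℕ} {f : A → B} → Injective _≡_ _≡_ f →
               Counts P k → Counts (λ y → ∃[ x ] P x × f x ≡ y) k
counts-image {P = P} {f = f} f-inj (L , unique , mem , len) =
  map f L , Unique.map⁺ f-inj unique , mem-image , trans (length-map f L) len
  where
  mem-image : ∀ y → (y ∈ map f L) ⇔ (∃[ x ] P x × f x ≡ y)
  mem-image y = mk⇔ (λ y∈ → let x , x∈L , y≡fx = ∈-map⁻ f y∈ in x , to (mem x) x∈L , sym y≡fx)
                    (λ { (x , Px , refl) → ∈-map⁺ f (from (mem x) Px) })

counts-split : {A : Set} {P Q : A → Set} {a b : ℕ} → (∀ x → Dec (Q x)) →
               Counts (λ x → P x × Q x) a → Counts (λ x → P x × ¬ Q x) b → Counts P (a + b)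
counts-split {P = P} Q? (L₁ , unique₁ , mem₁ , len₁) (L₂ , unique₂ , mem₂ , len₂) =
  L₁ ++ L₂ , Unique.++⁺ unique₁ unique₂ disjoint , mem , trans (length-++ L₁) (cong₂ _+_ len₁ len₂)
  where
  disjoint : Disjoint L₁ L₂
  disjoint (x∈L₁ , x∈L₂) = proj₂ (to (mem₂ _) x∈L₂) (proj₂ (to (mem₁ _) x∈L₁))
  mem : ∀ x → (x ∈ L₁ ++ L₂) ⇔ P x
  mem x = mk⇔ ([ (λ x∈ → proj₁ (to (mem₁ x) x∈)) , (λ x∈ → proj₁ (to (mem₂ x) x∈)) ]′ ∘ ∈-++⁻ L₁) from-P
    where
    from-P : P x → x ∈ L₁ ++ L₂
    from-P Px with Q? x
    ... | yes Qx = ∈-++⁺ˡ (from (mem₁ x) (Px , Qx))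
    ... | no ¬Qx = ∈-++⁺ʳ L₁ (from (mem₂ x) (Px , ¬Qx))

boundedLists : ℕ → ℕ → List (List ℕ)
boundedLists b zero = [] ∷ []
boundedLists b (suc ℓ) = [] ∷ concatMap (λ x → map (x ∷_) (boundedLists b ℓ)) (upTo (suc b))

∈-boundedLists : ∀ b ℓ {xs} → length xs ≤ ℓ → All (_≤ b) xs → xs ∈ boundedLists b ℓ
∈-boundedLists b zero {[]} _ _ = here refl
∈-boundedLists b (suc ℓ) {[]} _ _ = here refl
∈-boundedLists b (suc ℓ) {x ∷ xs} (s≤s len≤ℓ) (x≤b ∷ xs≤b) =
  there (∈-concatMap⁺ (λ y → map (y ∷_) (boundedLists b ℓ))
           (lose (∈-upTo⁺ (s≤s x≤b)) (∈-map⁺ (x ∷_) (∈-boundedLists b ℓ len≤ℓ xs≤b))))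

length≤sum : ∀ {xs} → All (0 <_) xs → length xs ≤ sum xs
length≤sum [] = z≤n
length≤sum (0<x ∷ 0<xs) = +-mono-≤ 0<x (length≤sum 0<xs)

parts≤sum : ∀ xs → All (_≤ sum xs) xs
parts≤sum [] = []
parts≤sum (x ∷ xs) = m≤m+n x (sum xs) ∷ All.map (λ y≤ → ≤-trans y≤ (m≤n+m (sum xs) x)) (parts≤sum xs)

partition-∈-boundedLists : ∀ {n xs} → IsPartition n xs → xs ∈ boundedLists n n
partition-∈-boundedLists {xs = xs} (_ , positive , refl) =
  ∈-boundedLists (sum xs) (sum xs) (length≤sum positive) (parts≤sum xs)

counts-partitions : ∀ {n} {P : List ℕ → Set} → (∀ xs → Dec (P xs)) →
                    (∀ {xs} → P xs → IsPartition n xs) → ∃[ k ] Counts P k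
counts-partitions {n} {P} P? P⇒partition = length L , L , deduplicate-! _≟ᴸ_ candidates , mem , refl
  where
  _≟ᴸ_ = ≡-dec _≟_
  candidates = filter P? (boundedLists n n)
  L = deduplicate _≟ᴸ_ candidates
  mem : ∀ xs → (xs ∈ L) ⇔ P xs
  mem xs = mk⇔ (λ xs∈ → proj₂ (∈-filter⁻ P? {xs = boundedLists n n} (∈-deduplicate⁻ _≟ᴸ_ candidates xs∈)))
               (λ Pxs → ∈-deduplicate⁺ _≟ᴸ_ (∈-filter⁺ P? (partition-∈-boundedLists (P⇒partition Pxs)) Pxs))

-- First-column hooks and numerical semigroups

hook≤sum+length : ∀ λs {h} → h ∈ firstColHooks λs → h ≤ sum λs + length λs
hook≤sum+length (p ∷ ps) (here refl) = +-mono-≤ (m≤m+n p (sum ps)) (n≤1+n (length ps))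
hook≤sum+length (p ∷ ps) (there h∈) =
  ≤-trans (hook≤sum+length ps h∈) (+-mono-≤ (m≤n+m (sum ps) p) (n≤1+n (length ps)))

hook≤head-hook : ∀ {q qs h} → Linked _≥_ (q ∷ qs) → h ∈ firstColHooks (q ∷ qs) → h ≤ q + length qs
hook≤head-hook _ (here refl) = ≤-refl
hook≤head-hook {qs = r ∷ rs} (r≤q ∷ linked) (there h∈) =
  ≤-trans (hook≤head-hook linked h∈) (+-mono-≤ r≤q (n≤1+n (length rs)))

hook≥2 : ∀ {λs h} → All (2 ≤_) λs → h ∈ firstColHooks λs → 2 ≤ h
hook≥2 {p ∷ ps} (2≤p ∷ _) (here refl) = ≤-trans 2≤p (m≤m+n p (length ps))
hook≥2 (_ ∷ ps≥2) (there h∈) = hook≥2 ps≥2 h∈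

sum+length<⇒InS : ∀ λs {x} → sum λs + length λs < x → InS λs x
sum+length<⇒InS λs x> x∈ = <⇒≱ x> (hook≤sum+length λs x∈)

InS-zero : ∀ {λs} → All (0 <_) λs → InS λs 0
InS-zero {p ∷ ps} (0<p ∷ _) (here 0≡) = <⇒≢ (≤-trans 0<p (m≤m+n p (length ps))) 0≡
InS-zero (_ ∷ positive) (there 0∈) = InS-zero positive 0∈

InS-cofinite : ∀ λs → ∃[ b ] (∀ x → b ≤ x → InS λs x)
InS-cofinite λs = suc (sum λs + length λs) , λ x → sum+length<⇒InS λs

AdditivelyClosed : (ℕ → Set) → Set
AdditivelyClosed S = ∀ x y → S x → S y → S (x + y)

numericalSemigroup⇔closed : ∀ {λs} → All (0 <_) λs →
                            IsNumericalSemigroup (InS λs) ⇔ AdditivelyClosed (InS λs)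
numericalSemigroup⇔closed {λs} positive =
  mk⇔ (proj₂ ∘ proj₂) (λ closed → InS-zero positive , InS-cofinite λs , closed)

InS? : ∀ λs x → Dec (InS λs x)
InS? λs x = ¬? (x ∈? firstColHooks λs)

additivelyClosed? : ∀ λs → Dec (AdditivelyClosed (InS λs))
additivelyClosed? λs =
  map′ closed-below⇒closed (λ closed _ _ → closed _ _)
       (allUpTo? (λ x → allUpTo? (λ y → InS? λs x →-dec (InS? λs y →-dec InS? λs (x + y))) b) b)
  where
  b = suc (sum λs + length λs)
  closed-below⇒closed : (∀ {x} → x < b → ∀ {y} → y < b → InS λs x → InS λs y → InS λs (x + y)) →
                        AdditivelyClosed (InS λs)
  closed-below⇒closed closed-below x y Sx Sy x+y∈ =
    closed-below (s≤s (≤-trans (m≤m+n x y) x+y≤)) (s≤s (≤-trans (m≤n+m y x) x+y≤)) Sx Sy x+y∈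
    where x+y≤ = hook≤sum+length λs x+y∈

isNumericalSemigroup? : ∀ λs → Dec (IsNumericalSemigroup (InS λs))
isNumericalSemigroup? λs =
  map′ (λ (S0 , closed) → S0 , InS-cofinite λs , closed) (λ (S0 , _ , closed) → S0 , closed)
       (InS? λs 0 ×-dec additivelyClosed? λs)

-- Appending k parts equal to 1

ones : ℕ → List ℕ
ones k = replicate k 1

∈-hooks-ones⁻ : ∀ k {x} → x ∈ firstColHooks (ones k) → 0 < x × x ≤ k
∈-hooks-ones⁻ (suc k) (here refl) rewrite length-replicate k {1} = z<s , ≤-refl
∈-hooks-ones⁻ (suc k) (there x∈) = map₂ m≤n⇒m≤1+n (∈-hooks-ones⁻ k x∈)

∈-hooks-ones⁺ : ∀ k {x} → 0 < x → x ≤ k → x ∈ firstColHooks (ones k)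
∈-hooks-ones⁺ zero 0<x x≤0 = contradiction x≤0 (<⇒≱ 0<x)
∈-hooks-ones⁺ (suc k) 0<x x≤1+k with m≤n⇒m<n∨m≡n x≤1+k
... | inj₁ x<1+k = there (∈-hooks-ones⁺ k 0<x (s≤s⁻¹ x<1+k))
... | inj₂ refl = here (cong suc (sym (length-replicate k)))

head-hook-++-ones : ∀ p ps k → p + length (ps ++ ones k) ≡ p + length ps + k
head-hook-++-ones p ps k = begin
  p + length (ps ++ ones k)     ≡⟨ cong (λ ℓ → p + ℓ) (length-++ ps) ⟩
  p + (length ps + length (ones k)) ≡⟨ cong (λ n → p + (length ps + n)) (length-replicate k) ⟩
  p + (length ps + k)           ≡⟨ +-assoc p (length ps) k ⟨
  p + length ps + k             ∎
  where open ≡-Reasoning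

∈-hooks-++-ones⁻ : ∀ μ k {x} → x ∈ firstColHooks (μ ++ ones k) →
                   (0 < x × x ≤ k) ⊎ ∃[ h ] h ∈ firstColHooks μ × x ≡ h + k
∈-hooks-++-ones⁻ [] k x∈ = inj₁ (∈-hooks-ones⁻ k x∈)
∈-hooks-++-ones⁻ (p ∷ ps) k (here refl) = inj₂ (p + length ps , here refl , head-hook-++-ones p ps k)
∈-hooks-++-ones⁻ (p ∷ ps) k (there x∈) =
  Sum.map₂ (λ (h , h∈ , x≡) → h , there h∈ , x≡) (∈-hooks-++-ones⁻ ps k x∈)

hooks-++-ones-low : ∀ μ k {x} → 0 < x → x ≤ k → x ∈ firstColHooks (μ ++ ones k)
hooks-++-ones-low [] k = ∈-hooks-ones⁺ k
hooks-++-ones-low (p ∷ ps) k 0<x x≤k = there (hooks-++-ones-low ps k 0<x x≤k)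

hooks-++-ones-shift : ∀ μ k {h} → h ∈ firstColHooks μ → h + k ∈ firstColHooks (μ ++ ones k)
hooks-++-ones-shift (p ∷ ps) k (here refl) = here (sym (head-hook-++-ones p ps k))
hooks-++-ones-shift (p ∷ ps) k (there h∈) = there (hooks-++-ones-shift ps k h∈)

InS-++-ones⇒k< : ∀ μ k {x} → InS (μ ++ ones k) x → 0 < x → k < x
InS-++-ones⇒k< μ k {x} Sx 0<x with k <? x
... | yes k<x = k<x
... | no k≮x = contradiction (hooks-++-ones-low μ k 0<x (≮⇒≥ k≮x)) Sx

Unsplittable : List ℕ → ℕ → Set
Unsplittable H d = ∀ {a b} → 0 < a → 0 < b → a + b ≡ d → a ∉ H → b ∉ H → ⊥

unsplittable-≤1 : ∀ {H d} → d ≤ 1 → Unsplittable H d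
unsplittable-≤1 d≤1 0<a 0<b a+b≡d _ _ = <⇒≱ (+-mono-≤ 0<a 0<b) (subst (_≤ 1) (sym a+b≡d) d≤1)

¬unsplittable-2 : ∀ {H} → 1 ∉ H → ¬ Unsplittable H 2
¬unsplittable-2 1∉H unsplit = unsplit z<s z<s refl 1∉H 1∉H

[a+b+k]+k≡[a+k]+[b+k] : ∀ a b k → a + b + k + k ≡ (a + k) + (b + k)
[a+b+k]+k≡[a+k]+[b+k] = solve 3 (λ a b k → a :+ b :+ k :+ k := (a :+ k) :+ (b :+ k)) refl
  where open +-*-Solver

InS-++-ones-shift : ∀ p ps k {a} → 0 < a → a < p + length ps → a ∉ firstColHooks ps →
                    InS ((p ∷ ps) ++ ones k) (a + k)
InS-++-ones-shift p ps k {a} 0<a a<h₁ a∉ a+k∈ with ∈-hooks-++-ones⁻ (p ∷ ps) k a+k∈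
... | inj₁ (_ , a+k≤k) = <⇒≱ (m<n+m k 0<a) a+k≤k
... | inj₂ (_ , here refl , a+k≡) = <⇒≢ a<h₁ (+-cancelʳ-≡ k a _ a+k≡)
... | inj₂ (h , there h∈ , a+k≡) = a∉ (subst (_∈ firstColHooks ps) (sym (+-cancelʳ-≡ k a h a+k≡)) h∈)

closed⇒unsplittable : ∀ p ps k → AdditivelyClosed (InS ((p ∷ ps) ++ ones k)) →
                      Unsplittable (firstColHooks ps) (p + length ps ∸ k)
closed⇒unsplittable p ps k closed {a} {b} 0<a 0<b a+b≡d a∉ b∉ =
  closed (a + k) (b + k) (InS-++-ones-shift p ps k 0<a a<h₁ a∉) (InS-++-ones-shift p ps k 0<b b<h₁ b∉)
         (subst (_∈ firstColHooks ((p ∷ ps) ++ ones k)) sum≡ (hooks-++-ones-shift (p ∷ ps) k (here refl)))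
  where
  h₁ = p + length ps
  k<h₁ : k < h₁
  k<h₁ = m∸n≢0⇒n<m (λ d≡0 → <⇒≢ (≤-trans 0<a (m≤m+n a b)) (sym (trans a+b≡d d≡0)))
  h₁≡ : a + b + k ≡ h₁
  h₁≡ = trans (cong (_+ k) a+b≡d) (m∸n+n≡m (<⇒≤ k<h₁))
  a<h₁ : a < h₁
  a<h₁ = subst (a <_) h₁≡ (≤-trans (m<m+n a 0<b) (m≤m+n (a + b) k))
  b<h₁ : b < h₁
  b<h₁ = subst (b <_) h₁≡ (≤-trans (m<n+m b 0<a) (m≤m+n (a + b) k))
  sum≡ : h₁ + k ≡ (a + k) + (b + k)
  sum≡ = trans (cong (_+ k) (sym h₁≡)) ([a+b+k]+k≡[a+k]+[b+k] a b k)

-- Nonzero elements of S exceed k, so a sum of two of them exceeds 2k + 1, hence every shifted tail hook: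
-- only the top hook h₁ + k can be hit.
unsplittable⇒closed : ∀ p ps k → (∀ {h} → h ∈ firstColHooks ps → h ≤ suc k) →
                      Unsplittable (firstColHooks ps) (p + length ps ∸ k) →
                      AdditivelyClosed (InS ((p ∷ ps) ++ ones k))
unsplittable⇒closed p ps k _ _ zero y _ Sy = Sy
unsplittable⇒closed p ps k _ _ x@(suc _) zero Sx _ = subst (InS _) (sym (+-identityʳ x)) Sx
unsplittable⇒closed p ps k bound unsplit x@(suc _) y@(suc _) Sx Sy x+y∈
  with InS-++-ones⇒k< (p ∷ ps) k Sx z<s | InS-++-ones⇒k< (p ∷ ps) k Sy z<s | ∈-hooks-++-ones⁻ (p ∷ ps) k x+y∈
... | k<x | k<y | inj₁ (_ , x+y≤k) = <⇒≱ (≤-trans k<x (m≤m+n x y)) x+y≤k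
... | k<x | k<y | inj₂ (h , there h∈ , x+y≡) =
  <⇒≱ (≤-trans (+-monoʳ-< (suc k) (n<1+n k)) (+-mono-≤ k<x k<y))
      (subst (_≤ suc k + k) (sym x+y≡) (+-monoˡ-≤ k (bound h∈)))
... | k<x | k<y | inj₂ (_ , here refl , x+y≡) = unsplit (m<n⇒0<n∸m k<x) (m<n⇒0<n∸m k<y) a+b≡d a∉ b∉
  where
  open ≡-Reasoning
  a = x ∸ k
  b = y ∸ k
  a+k≡x : a + k ≡ x
  a+k≡x = m∸n+n≡m (<⇒≤ k<x)
  b+k≡y : b + k ≡ y
  b+k≡y = m∸n+n≡m (<⇒≤ k<y)
  a+b≡d : a + b ≡ p + length ps ∸ k
  a+b≡d = begin
    a + b             ≡⟨ m+n∸n≡m (a + b) k ⟨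
    a + b + k ∸ k     ≡⟨ cong (_∸ k) (+-cancelʳ-≡ k _ _ (trans ([a+b+k]+k≡[a+k]+[b+k] a b k)
                                                          (trans (cong₂ _+_ a+k≡x b+k≡y) x+y≡))) ⟩
    p + length ps ∸ k ∎
  a∉ : a ∉ firstColHooks ps
  a∉ a∈ = Sx (subst (_∈ firstColHooks ((p ∷ ps) ++ ones k)) a+k≡x (hooks-++-ones-shift (p ∷ ps) k (there a∈)))
  b∉ : b ∉ firstColHooks ps
  b∉ b∈ = Sy (subst (_∈ firstColHooks ((p ∷ ps) ++ ones k)) b+k≡y (hooks-++-ones-shift (p ∷ ps) k (there b∈)))

semigroup⇔unsplittable : ∀ {p ps k} → All (0 <_) (p ∷ ps) → (∀ {h} → h ∈ firstColHooks ps → h ≤ suc k) →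
                         IsNumericalSemigroup (InS ((p ∷ ps) ++ ones k)) ⇔
                         Unsplittable (firstColHooks ps) (p + length ps ∸ k)
semigroup⇔unsplittable {p} {ps} {k} positive bound =
  ⇔-trans (numericalSemigroup⇔closed (++⁺ positive (replicate⁺ k z<s)))
          (mk⇔ (closed⇒unsplittable p ps k) (unsplittable⇒closed p ps k bound))

-- (suc p + length ps) ∸ suc k reduces to p + length ps ∸ k, so both sides are the same
-- unsplittability condition.
semigroup-incHead⇔ : ∀ {p ps k} → All (0 <_) (p ∷ ps) → (∀ {h} → h ∈ firstColHooks ps → h ≤ suc k) →
                     IsNumericalSemigroup (InS ((p ∷ ps) ++ ones k)) ⇔
                     IsNumericalSemigroup (InS ((suc p ∷ ps) ++ ones (suc k)))
semigroup-incHead⇔ {k = k} (0<p ∷ positive) bound =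
  ⇔-trans (semigroup⇔unsplittable (0<p ∷ positive) bound)
          (⇔-sym (semigroup⇔unsplittable {k = suc k} (z<s ∷ positive) (m≤n⇒m≤1+n ∘ bound)))

-- Partitions as a ones-free part plus k ones

PartitionWithoutOnes : ℕ → List ℕ → Set
PartitionWithoutOnes n μ = IsPartition n μ × All (2 ≤_) μ

PMCore : ℕ → ℕ → List ℕ → Set
PMCore n k μ = PartitionWithoutOnes n μ × IsNumericalSemigroup (InS (μ ++ ones k))

2≤⇒0< : ∀ {x} → 2 ≤ x → 0 < x
2≤⇒0< (s≤s _) = z<s

2≤⇒≢1 : ∀ {x} → 2 ≤ x → x ≢ 1
2≤⇒≢1 (s≤s ()) refl

0<∧≢1⇒2≤ : ∀ {x} → 0 < x → x ≢ 1 → 2 ≤ x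
0<∧≢1⇒2≤ {1} _ x≢1 with () ← x≢1 refl
0<∧≢1⇒2≤ {suc (suc _)} _ _ = s≤s (s≤s z≤n)

sum-ones : ∀ k → sum (ones k) ≡ k
sum-ones zero = refl
sum-ones (suc k) = cong suc (sum-ones k)

sum-++-ones : ∀ μ k → sum (μ ++ ones k) ≡ sum μ + k
sum-++-ones μ k = trans (sum-++ μ (ones k)) (cong (λ s → sum μ + s) (sum-ones k))

onesCount-ones : ∀ k → onesCount (ones k) ≡ k
onesCount-ones zero = refl
onesCount-ones (suc k) = cong suc (onesCount-ones k)

onesCount-++-ones : ∀ {μ} k → All (2 ≤_) μ → onesCount (μ ++ ones k) ≡ k
onesCount-++-ones k [] = onesCount-ones k
onesCount-++-ones k (2≤p ∷ μ≥2) =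
  trans (cong length (filter-reject (_≟ 1) (2≤⇒≢1 2≤p))) (onesCount-++-ones k μ≥2)

Linked-ones : ∀ k → Linked _≥_ (ones k)
Linked-ones zero = []
Linked-ones (suc zero) = [-]
Linked-ones (suc (suc k)) = ≤-refl ∷ Linked-ones (suc k)

Linked-++-ones : ∀ {μ} k → Linked _≥_ μ → All (2 ≤_) μ → Linked _≥_ (μ ++ ones k)
Linked-++-ones k [] [] = Linked-ones k
Linked-++-ones zero [-] _ = [-]
Linked-++-ones (suc k) [-] (2≤p ∷ []) = 2≤⇒0< 2≤p ∷ Linked-ones (suc k)
Linked-++-ones k (q≤p ∷ linked) (_ ∷ μ≥2) = q≤p ∷ Linked-++-ones k linked μ≥2

Linked-++⁻ˡ : ∀ {A : Set} {R : A → A → Set} xs {ys} → Linked R (xs ++ ys) → Linked R xs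
Linked-++⁻ˡ [] _ = []
Linked-++⁻ˡ (x ∷ []) _ = [-]
Linked-++⁻ˡ (x ∷ y ∷ xs) (r ∷ linked) = r ∷ Linked-++⁻ˡ (y ∷ xs) linked

all-ones : ∀ {xs} → Linked _≥_ (1 ∷ xs) → All (0 <_) xs → 1 ∷ xs ≡ ones (suc (length xs))
all-ones {[]} _ _ = refl
all-ones {x ∷ xs} (x≤1 ∷ linked) (0<x ∷ positive) with ≤-antisym x≤1 0<x
... | refl = cong (1 ∷_) (all-ones linked positive)

ones-suffix : ∀ {y k} → Linked _≥_ y → All (0 <_) y → onesCount y ≡ k →
              ∃[ μ ] All (2 ≤_) μ × y ≡ μ ++ ones k
ones-suffix {[]} _ _ refl = [] , [] , refl
ones-suffix {x ∷ xs} {k} linked (0<x ∷ positive) count≡ with x ≟ 1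
... | yes refl = [] , [] , trans y≡ones (cong ones length≡k)
  where
  y≡ones = all-ones linked positive
  length≡k : suc (length xs) ≡ k
  length≡k = trans (sym (onesCount-ones _)) (trans (cong onesCount (sym y≡ones)) count≡)
... | no x≢1 =
  let μ , μ≥2 , xs≡ = ones-suffix (Linked.tail linked) positive
                        (trans (sym (cong length (filter-reject (_≟ 1) x≢1))) count≡)
  in x ∷ μ , 0<∧≢1⇒2≤ 0<x x≢1 ∷ μ≥2 , cong (x ∷_) xs≡

pm⇔core : ∀ {n m k M y} → n ≡ m + k → M ∸ 1 ≡ k →
          PMPred n M y ⇔ (∃[ μ ] PMCore m k μ × μ ++ ones k ≡ y)
pm⇔core {n} {m} {k} {M} n≡m+k M∸1≡k = mk⇔ split join
  where
  split : ∀ {y} → PMPred n M y → ∃[ μ ] PMCore m k μ × μ ++ ones k ≡ y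
  split ((linked , positive , sum≡n) , count≡ , sg) with ones-suffix linked positive (trans count≡ M∸1≡k)
  ... | μ , μ≥2 , refl =
    μ , (((Linked-++⁻ˡ μ linked , All.map 2≤⇒0< μ≥2 , sum≡m) , μ≥2) , sg) , refl
    where
    sum≡m : sum μ ≡ m
    sum≡m = +-cancelʳ-≡ k (sum μ) m (trans (sym (sum-++-ones μ k)) (trans sum≡n n≡m+k))
  join : ∀ {y} → ∃[ μ ] PMCore m k μ × μ ++ ones k ≡ y → PMPred n M y
  join (μ , (((linked , _ , sum≡m) , μ≥2) , sg) , refl) =
    (Linked-++-ones k linked μ≥2 , ++⁺ (All.map 2≤⇒0< μ≥2) (replicate⁺ k z<s) , sum≡n) ,
    trans (onesCount-++-ones k μ≥2) (sym M∸1≡k) , sg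
    where
    sum≡n : sum (μ ++ ones k) ≡ n
    sum≡n = trans (sum-++-ones μ k) (trans (cong (_+ k) sum≡m) (sym n≡m+k))

FirstTwoEqual⇒2≤length : ∀ {x} → FirstTwoEqual x → 2 ≤ length x
FirstTwoEqual⇒2≤length {_ ∷ _ ∷ _} _ = s≤s (s≤s z≤n)

abar⇔ : ∀ {n x} → ABarPred n x ⇔ (PartitionWithoutOnes n x × FirstTwoEqual x)
abar⇔ = mk⇔ (λ (part@(_ , positive , _) , _ , no-ones , fte) →
                (part , All.zipWith (λ (0<p , p≢1) → 0<∧≢1⇒2≤ 0<p p≢1) (positive , no-ones)) , fte)
            (λ ((part , x≥2) , fte) → part , FirstTwoEqual⇒2≤length fte , All.map 2≤⇒≢1 x≥2 , fte)

isPartition? : ∀ n xs → Dec (IsPartition n xs)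
isPartition? n xs = linked? (λ a b → b ≤? a) xs ×-dec (All.all? (0 <?_) xs ×-dec (sum xs ≟ n))

partitionWithoutOnes? : ∀ n μ → Dec (PartitionWithoutOnes n μ)
partitionWithoutOnes? n μ = isPartition? n μ ×-dec All.all? (2 ≤?_) μ

pmCore? : ∀ n k μ → Dec (PMCore n k μ)
pmCore? n k μ = partitionWithoutOnes? n μ ×-dec isNumericalSemigroup? (μ ++ ones k)

firstTwoEqual? : ∀ x → Dec (FirstTwoEqual x)
firstTwoEqual? [] = no λ ()
firstTwoEqual? (_ ∷ []) = no λ ()
firstTwoEqual? (a ∷ b ∷ _) = a ≟ b

abar? : ∀ n x → Dec (ABarPred n x)
abar? n x =
  isPartition? n x ×-dec ((2 ≤? length x) ×-dec (All.all? (λ p → ¬? (p ≟ 1)) x ×-dec firstTwoEqual? x))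

2*n+1≡1+[n+n] : ∀ n → 2 * n + 1 ≡ suc (n + n)
2*n+1≡1+[n+n] = solve 1 (λ n → con 2 :* n :+ con 1 := con 1 :+ (n :+ n)) refl
  where open +-*-Solver

2*n+2≡[1+n]+[1+n] : ∀ n → 2 * n + 2 ≡ suc n + suc n
2*n+2≡[1+n]+[1+n] = solve 1 (λ n → con 2 :* n :+ con 2 := (con 1 :+ n) :+ (con 1 :+ n)) refl
  where open +-*-Solver

[m+n]+[m+n]≡[m+m]+[n+n] : ∀ m n → (m + n) + (m + n) ≡ (m + m) + (n + n)
[m+n]+[m+n]≡[m+m]+[n+n] = solve 2 (λ m n → (m :+ n) :+ (m :+ n) := (m :+ m) :+ (n :+ n)) refl
  where open +-*-Solver

m+m≤1+[n+n]⇒m≤n : ∀ {m n} → m + m ≤ suc (n + n) → m ≤ n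
m+m≤1+[n+n]⇒m≤n {zero} _ = z≤n
m+m≤1+[n+n]⇒m≤n {suc m} {zero} (s≤s m+1+m≤0) = contradiction (subst (_≤ 0) (+-suc m m) m+1+m≤0) λ ()
m+m≤1+[n+n]⇒m≤n {suc m} {suc n} (s≤s le) =
  s≤s (m+m≤1+[n+n]⇒m≤n (s≤s⁻¹ (subst₂ _≤_ (+-suc m m) (cong suc (+-suc n n)) le)))

length+length≤sum : ∀ {xs} → All (2 ≤_) xs → length xs + length xs ≤ sum xs
length+length≤sum [] = z≤n
length+length≤sum {x ∷ xs} (2≤x ∷ xs≥2) =
  subst (_≤ x + sum xs) (cong suc (sym (+-suc (length xs) (length xs))))
        (+-mono-≤ 2≤x (length+length≤sum xs≥2))

tail-hook≤ : ∀ {p ps b h} → Linked _≥_ (p ∷ ps) → All (2 ≤_) ps → sum (p ∷ ps) ≤ suc (b + b) →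
             h ∈ firstColHooks ps → h ≤ b
tail-hook≤ {p} {q ∷ qs} {b} {h} (q≤p ∷ linked) (_ ∷ qs≥2) sum≤ h∈ =
  m+m≤1+[n+n]⇒m≤n (≤-trans (+-mono-≤ h≤ h≤) (≤-trans double≤sum sum≤))
  where
  open ≤-Reasoning
  h≤ : h ≤ q + length qs
  h≤ = hook≤head-hook linked h∈
  double≤sum : (q + length qs) + (q + length qs) ≤ p + (q + sum qs)
  double≤sum = begin
    (q + length qs) + (q + length qs) ≡⟨ [m+n]+[m+n]≡[m+m]+[n+n] q (length qs) ⟩
    (q + q) + (length qs + length qs) ≤⟨ +-mono-≤ (+-monoˡ-≤ q q≤p) (length+length≤sum qs≥2) ⟩
    (p + q) + sum qs                  ≡⟨ +-assoc p q (sum qs) ⟩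
    p + (q + sum qs)                  ∎

-- A strictly largest first part

incHead : List ℕ → List ℕ
incHead [] = []
incHead (p ∷ ps) = suc p ∷ ps

incHead-injective : ∀ {xs ys} → incHead xs ≡ incHead ys → xs ≡ ys
incHead-injective {[]} {[]} _ = refl
incHead-injective {_ ∷ _} {_ ∷ _} refl = refl

Linked-≤-head : ∀ {p q ps} → p ≤ q → Linked _≥_ (p ∷ ps) → Linked _≥_ (q ∷ ps)
Linked-≤-head _ [-] = [-]
Linked-≤-head p≤q (r≤p ∷ linked) = ≤-trans r≤p p≤q ∷ linked

Linked-strict-head : ∀ {p ps} → Linked _≥_ (suc p ∷ ps) → ¬ FirstTwoEqual (suc p ∷ ps) → Linked _≥_ (p ∷ ps)
Linked-strict-head [-] _ = [-]
Linked-strict-head (q≤1+p ∷ linked) ¬fte = s≤s⁻¹ (≤∧≢⇒< q≤1+p (¬fte ∘ sym)) ∷ linked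

incHead-¬FirstTwoEqual : ∀ {p ps} → Linked _≥_ (p ∷ ps) → ¬ FirstTwoEqual (suc p ∷ ps)
incHead-¬FirstTwoEqual [-] ()
incHead-¬FirstTwoEqual (q≤p ∷ _) 1+p≡q = <⇒≢ (s≤s q≤p) (sym 1+p≡q)

head≥2 : ∀ {p ps} → Linked _≥_ (p ∷ ps) → All (2 ≤_) ps → 2 ≤ sum (p ∷ ps) → 2 ≤ p
head≥2 {ps = []} _ _ 2≤p+0 = subst (2 ≤_) (+-identityʳ _) 2≤p+0
head≥2 {ps = _ ∷ _} (q≤p ∷ _) (2≤q ∷ _) _ = ≤-trans 2≤q q≤p

strictHead⇒incHead : ∀ {k ν} → PMCore (2 * suc k + 2) (suc k) ν → ¬ FirstTwoEqual ν →
                     ∃[ μ ] PMCore (2 * suc k + 1) k μ × incHead μ ≡ ν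
strictHead⇒incHead {k} {suc p ∷ ps} (((linked , _ , sum≡) , _ ∷ ps≥2) , sg) ¬fte =
  p ∷ ps , (((linked′ , All.map 2≤⇒0< μ≥2 , sum′) , μ≥2) ,
            from (semigroup-incHead⇔ (All.map 2≤⇒0< μ≥2) bound) sg) , refl
  where
  linked′ = Linked-strict-head linked ¬fte
  sum′ : p + sum ps ≡ 2 * suc k + 1
  sum′ = suc-injective (trans sum≡ (+-suc (2 * suc k) 1))
  μ≥2 : All (2 ≤_) (p ∷ ps)
  μ≥2 = head≥2 linked′ ps≥2 (subst (2 ≤_) (sym sum′) (≤-trans (m≤m*n 2 (suc k)) (m≤m+n _ 1))) ∷ ps≥2
  bound : ∀ {h} → h ∈ firstColHooks ps → h ≤ suc k
  bound = tail-hook≤ linked′ ps≥2 (≤-reflexive (trans sum′ (2*n+1≡1+[n+n] (suc k))))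

incHead⇒strictHead : ∀ {k μ} → PMCore (2 * suc k + 1) k μ →
                     PMCore (2 * suc k + 2) (suc k) (incHead μ) × ¬ FirstTwoEqual (incHead μ)
incHead⇒strictHead {k} {p ∷ ps} (((linked , positive , sum≡) , 2≤p ∷ ps≥2) , sg) =
  (((Linked-≤-head (n≤1+n p) linked , z<s ∷ All.tail positive , sum′) , m≤n⇒m≤1+n 2≤p ∷ ps≥2) ,
   to (semigroup-incHead⇔ positive bound) sg) ,
  incHead-¬FirstTwoEqual linked
  where
  sum′ : suc p + sum ps ≡ 2 * suc k + 2
  sum′ = trans (cong suc sum≡) (sym (+-suc (2 * suc k) 1))
  bound : ∀ {h} → h ∈ firstColHooks ps → h ≤ suc k
  bound = tail-hook≤ linked ps≥2 (≤-reflexive (trans sum≡ (2*n+1≡1+[n+n] (suc k))))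

strictHead⇔incHead : ∀ {k ν} → (PMCore (2 * suc k + 2) (suc k) ν × ¬ FirstTwoEqual ν) ⇔
                     (∃[ μ ] PMCore (2 * suc k + 1) k μ × incHead μ ≡ ν)
strictHead⇔incHead = mk⇔ (λ (core , ¬fte) → strictHead⇒incHead core ¬fte)
                         (λ { (μ , core , refl) → incHead⇒strictHead core })

-- Two equal largest parts

twinHead⇔abar : ∀ {n j x} → (PMCore n j x × FirstTwoEqual x) ⇔
                (ABarPred n x × IsNumericalSemigroup (InS (x ++ ones j)))
twinHead⇔abar = mk⇔ (λ ((pwo , sg) , fte) → from abar⇔ (pwo , fte) , sg)
                    (λ (abar , sg) → let pwo , fte = to abar⇔ abar in (pwo , sg) , fte)

sum-twos : ∀ L → sum (replicate L 2) ≡ L + L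
sum-twos zero = refl
sum-twos (suc L) = cong suc (trans (cong suc (sum-twos L)) (sym (+-suc L L)))

twos-forced : ∀ {xs} → All (2 ≤_) xs → sum xs ≡ length xs + length xs → xs ≡ replicate (length xs) 2
twos-forced [] _ = refl
twos-forced {x ∷ xs} (2≤x ∷ xs≥2) sum≡ = cong₂ _∷_ x≡2 (twos-forced xs≥2 sum-xs≡)
  where
  sum≡′ : x + sum xs ≡ 2 + (length xs + length xs)
  sum≡′ = trans sum≡ (cong suc (+-suc (length xs) (length xs)))
  x≡2 : x ≡ 2
  x≡2 = ≤-antisym (+-cancelʳ-≤ (sum xs) x 2 (subst (_≤ 2 + sum xs) (sym sum≡′)
                                              (+-monoʳ-≤ 2 (length+length≤sum xs≥2))))
                  2≤x
  sum-xs≡ : sum xs ≡ length xs + length xs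
  sum-xs≡ = +-cancelˡ-≡ 2 _ _ (trans (cong (_+ sum xs) (sym x≡2)) sum≡′)

c+[c+[L+L]]≡[c+L]+[c+L] : ∀ c L → c + (c + (L + L)) ≡ (c + L) + (c + L)
c+[c+[L+L]]≡[c+L]+[c+L] = solve 2 (λ c L → c :+ (c :+ (L :+ L)) := (c :+ L) :+ (c :+ L)) refl
  where open +-*-Solver

twinHead-tail-hook≤ : ∀ {j c rest h} → PartitionWithoutOnes (2 * j + 2) (c ∷ c ∷ rest) →
                      h ∈ firstColHooks (c ∷ rest) → h ≤ suc j
twinHead-tail-hook≤ {j} ((linked , _ , sum≡) , _ ∷ tail≥2) =
  tail-hook≤ linked tail≥2 (≤-trans (≤-reflexive (trans sum≡ (2*n+2≡[1+n]+[1+n] j))) (n≤1+n _))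

-- The top tail hook c + ℓ(rest) is at most j + 1. If it equals j + 1 the number to split is 2 = 1 + 1,
-- and 1 is not a hook; otherwise the number to split is at most 1.
twinHead-semigroup⇔ : ∀ {j c rest} → PartitionWithoutOnes (2 * j + 2) (c ∷ c ∷ rest) →
                      IsNumericalSemigroup (InS ((c ∷ c ∷ rest) ++ ones j)) ⇔ c + length rest ≤ j
twinHead-semigroup⇔ {j} {c} {rest} pwo@((_ , positive , _) , _ ∷ tail≥2) =
  ⇔-trans (semigroup⇔unsplittable positive (twinHead-tail-hook≤ pwo)) (mk⇔ unsplittable⇒≤ ≤⇒unsplittable)
  where
  d≡ : c + length (c ∷ rest) ∸ j ≡ suc (c + length rest) ∸ j
  d≡ = cong (_∸ j) (+-suc c (length rest))
  unsplittable⇒≤ : Unsplittable (firstColHooks (c ∷ rest)) (c + length (c ∷ rest) ∸ j) → c + length rest ≤ j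
  unsplittable⇒≤ unsplit with m≤n⇒m<n∨m≡n (twinHead-tail-hook≤ pwo (here refl))
  ... | inj₁ top<1+j = s≤s⁻¹ top<1+j
  ... | inj₂ top≡1+j = ⊥-elim (¬unsplittable-2 1∉ (subst (Unsplittable _) d≡2 unsplit))
    where
    1∉ : 1 ∉ firstColHooks (c ∷ rest)
    1∉ 1∈ = 1+n≰n (hook≥2 tail≥2 1∈)
    d≡2 : c + length (c ∷ rest) ∸ j ≡ 2
    d≡2 = trans d≡ (trans (cong (λ t → suc t ∸ j) top≡1+j) (m+n∸n≡m 2 j))
  ≤⇒unsplittable : c + length rest ≤ j → Unsplittable (firstColHooks (c ∷ rest)) (c + length (c ∷ rest) ∸ j)
  ≤⇒unsplittable top≤j =
    unsplittable-≤1 (subst (_≤ 1) (sym d≡) (≤-trans (∸-monoˡ-≤ j (s≤s top≤j)) (≤-reflexive (m+n∸n≡m 1 j))))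

twinHeadTwos : ℕ → ℕ → List ℕ
twinHeadTwos j L = suc j ∸ L ∷ suc j ∸ L ∷ replicate L 2

twinHeadTwos-injective : ∀ {j L L′} → twinHeadTwos j L ≡ twinHeadTwos j L′ → L ≡ L′
twinHeadTwos-injective {L = L} {L′} eq =
  trans (sym (length-replicate L))
        (trans (cong length (∷-injectiveʳ (∷-injectiveʳ eq))) (length-replicate L′))

nonSemigroup⇒twinHeadTwos : ∀ {j c rest} → PartitionWithoutOnes (2 * j + 2) (c ∷ c ∷ rest) →
                            ¬ IsNumericalSemigroup (InS ((c ∷ c ∷ rest) ++ ones j)) →
                            length rest < j × twinHeadTwos j (length rest) ≡ c ∷ c ∷ rest
nonSemigroup⇒twinHeadTwos {j} {c} {rest} pwo@((_ , _ , sum≡) , 2≤c ∷ _ ∷ rest≥2) ¬sg =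
  L<j , cong₂ (λ a r → a ∷ a ∷ r) c≡ (sym rest≡)
  where
  open ≡-Reasoning
  L = length rest
  top≡ : c + L ≡ suc j
  top≡ = ≤-antisym (twinHead-tail-hook≤ pwo (here refl)) (≰⇒> (¬sg ∘ from (twinHead-semigroup⇔ pwo)))
  L<j : L < j
  L<j = s≤s⁻¹ (subst (2 + L ≤_) top≡ (+-monoˡ-≤ L 2≤c))
  c≡ : suc j ∸ L ≡ c
  c≡ = trans (cong (_∸ L) (sym top≡)) (m+n∸n≡m c L)
  sum-rest : sum rest ≡ L + L
  sum-rest = +-cancelˡ-≡ c _ _ (+-cancelˡ-≡ c _ _ (begin
    c + (c + sum rest)  ≡⟨ sum≡ ⟩
    2 * j + 2           ≡⟨ 2*n+2≡[1+n]+[1+n] j ⟩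
    suc j + suc j       ≡⟨ cong (λ t → t + t) top≡ ⟨
    (c + L) + (c + L)   ≡⟨ c+[c+[L+L]]≡[c+L]+[c+L] c L ⟨
    c + (c + (L + L))   ∎))
  rest≡ : rest ≡ replicate L 2
  rest≡ = twos-forced rest≥2 sum-rest

Linked-twos : ∀ {c} L → 2 ≤ c → Linked _≥_ (c ∷ replicate L 2)
Linked-twos zero _ = [-]
Linked-twos (suc L) 2≤c = 2≤c ∷ Linked-twos L ≤-refl

twinHeadTwos-nonSemigroup : ∀ {j L} → L < j →
                            ABarPred (2 * j + 2) (twinHeadTwos j L) ×
                            ¬ IsNumericalSemigroup (InS (twinHeadTwos j L ++ ones j))
twinHeadTwos-nonSemigroup {j} {L} L<j = from abar⇔ (pwo , refl) , λ sg → 1+n≰n (top≤j sg)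
  where
  open ≡-Reasoning
  c = suc j ∸ L
  c+L≡ : c + L ≡ suc j
  c+L≡ = m∸n+n≡m (m≤n⇒m≤1+n (<⇒≤ L<j))
  2≤c : 2 ≤ c
  2≤c = subst (2 ≤_) (sym (+-∸-assoc 1 (<⇒≤ L<j))) (s≤s (m<n⇒0<n∸m L<j))
  parts≥2 : All (2 ≤_) (twinHeadTwos j L)
  parts≥2 = 2≤c ∷ 2≤c ∷ replicate⁺ L ≤-refl
  sum≡ : c + (c + sum (replicate L 2)) ≡ 2 * j + 2
  sum≡ = begin
    c + (c + sum (replicate L 2)) ≡⟨ cong (λ s → c + (c + s)) (sum-twos L) ⟩
    c + (c + (L + L))             ≡⟨ c+[c+[L+L]]≡[c+L]+[c+L] c L ⟩
    (c + L) + (c + L)             ≡⟨ cong (λ t → t + t) c+L≡ ⟩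
    suc j + suc j                 ≡⟨ 2*n+2≡[1+n]+[1+n] j ⟨
    2 * j + 2                     ∎
  pwo : PartitionWithoutOnes (2 * j + 2) (twinHeadTwos j L)
  pwo = (≤-refl ∷ Linked-twos L 2≤c , All.map 2≤⇒0< parts≥2 , sum≡) , parts≥2
  top≤j : IsNumericalSemigroup (InS (twinHeadTwos j L ++ ones j)) → suc j ≤ j
  top≤j sg = subst (_≤ j) (trans (cong (λ ℓ → c + ℓ) (length-replicate L)) c+L≡)
                   (to (twinHead-semigroup⇔ pwo) sg)

abar-nonSemigroup⇔twinHeadTwos : ∀ {j x} →
  (ABarPred (2 * j + 2) x × ¬ IsNumericalSemigroup (InS (x ++ ones j))) ⇔
  (∃[ L ] L < j × twinHeadTwos j L ≡ x)
abar-nonSemigroup⇔twinHeadTwos = mk⇔ twinHead (λ { (L , L<j , refl) → twinHeadTwos-nonSemigroup L<j })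
  where
  twinHead : ∀ {j x} → ABarPred (2 * j + 2) x × ¬ IsNumericalSemigroup (InS (x ++ ones j)) →
             ∃[ L ] L < j × twinHeadTwos j L ≡ x
  twinHead {x = []} ((_ , _ , _ , ()) , _)
  twinHead {x = _ ∷ []} ((_ , _ , _ , ()) , _)
  twinHead {x = c ∷ c′ ∷ rest} (abar , ¬sg) with to abar⇔ abar
  ... | pwo , refl = length rest , nonSemigroup⇒twinHeadTwos pwo ¬sg

3*[1+n]≡[2*[1+n]+1]+n : ∀ n → 3 * suc n ≡ (2 * suc n + 1) + n
3*[1+n]≡[2*[1+n]+1]+n = solve 1 (λ n → con 3 :* (con 1 :+ n) := (con 2 :* (con 1 :+ n) :+ con 1) :+ n) refl
  where open +-*-Solver

3*n+2≡[2*n+2]+n : ∀ n → 3 * n + 2 ≡ (2 * n + 2) + n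
3*n+2≡[2*n+2]+n = solve 1 (λ n → con 3 :* n :+ con 2 := (con 2 :* n :+ con 2) :+ n) refl
  where open +-*-Solver

+[m+n]-+n≡+m : ∀ m n → + (m + n) - + n ≡ + m
+[m+n]-+n≡+m m n = trans ([+m]-[+n]≡m⊖n (m + n) n) (trans (⊖-≥ (m≤n+m n m)) (cong +_ (m+n∸n≡m m n)))

-- The identity holds for every j ≥ 1; the hypothesis 4 ≤ j is used only to exclude j = 0.
theorem5p7 : (j : ℕ) → 4 ≤ j →
    Σ ℕ λ pm1 → Σ ℕ λ pm2 → Σ ℕ λ abar →
      HasCount (PMPred (3 * j + 2) (j + 1)) pm1 ×
      HasCount (PMPred (3 * j) j) pm2 ×
      HasCount (ABarPred (2 * j + 2)) abar ×
      ((+ pm1) - (+ pm2) ≡ (+ abar) - (+ j))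
theorem5p7 j@(suc k) _
  with counts-partitions (pmCore? (2 * j + 1) k) (proj₁ ∘ proj₁)
     | counts-partitions (λ x → abar? (2 * j + 2) x ×-dec isNumericalSemigroup? (x ++ ones j)) (proj₁ ∘ proj₁)
... | a , cores₂ | b , semigroupABar =
  b + a , a , b + j , pm₁ , pm₂ , abar , trans (+[m+n]-+n≡+m b a) (sym (+[m+n]-+n≡+m b j))
  where
  cores₁ : Counts (PMCore (2 * j + 2) j) (b + a)
  cores₁ = counts-split firstTwoEqual? (counts-⇔ (λ _ → ⇔-sym twinHead⇔abar) semigroupABar)
                                      (counts-⇔ (λ _ → ⇔-sym strictHead⇔incHead)
                                                (counts-image incHead-injective cores₂))
  pm₁ : Counts (PMPred (3 * j + 2) (j + 1)) (b + a)
  pm₁ = counts-⇔ (λ _ → ⇔-sym (pm⇔core {M = j + 1} (3*n+2≡[2*n+2]+n j) (m+n∸n≡m j 1)))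
                 (counts-image (++-cancelʳ (ones j) _ _) cores₁)
  pm₂ : Counts (PMPred (3 * j) j) a
  pm₂ = counts-⇔ (λ _ → ⇔-sym (pm⇔core {M = j} (3*[1+n]≡[2*[1+n]+1]+n k) refl))
                 (counts-image (++-cancelʳ (ones k) _ _) cores₂)
  abar : Counts (ABarPred (2 * j + 2)) (b + j)
  abar = counts-split (λ x → isNumericalSemigroup? (x ++ ones j)) semigroupABar
                      (counts-⇔ (λ _ → ⇔-sym abar-nonSemigroup⇔twinHeadTwos)
                                (counts-image twinHeadTwos-injective (counts-upTo j)))
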